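{- Let $n,m$ be positive integers. There exists a Type II solution $(x,y,z)\in\mathbb N^3$ of $\frac mn=\frac1x+\frac1y+\frac1z$ if and only if there exist $a,b,e\in\mathbb N$ with $e\mid a+b$, $mab\mid n+e$, and $(n+e)/m$ coprime to $n$.
   Context: $\mathbb N$ denotes the positive integers. A solution $(x,y,z)\in\mathbb N^3$ of $\frac mn=\frac1x+\frac1y+\frac1z$ is of Type II if $n$ divides both $y$ and $z$ but $n$ is coprime to $x$. -}

module Defs where

open import Data.Nat using (ℕ; _+_; _*_; _<_)
open import Data.Nat.Divisibility using (_∣_)
open import Data.Nat.Coprimality using (Coprime)
open import Data.Product using (_×_; ∃-syntax)
open import Relation.Binary.PropositionalEquality using (_≡_)
open import Relation.Nullary using (¬_)

-- m/n = 1/x + 1/y + 1/z, cleared of denominators (all of n,x,y,z positive)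
SolvesEq : ℕ → ℕ → ℕ → ℕ → ℕ → Set
SolvesEq m n x y z = m * (x * y * z) ≡ n * (y * z + x * z + x * y)

TypeIISolution : ℕ → ℕ → ℕ → ℕ → ℕ → Set
TypeIISolution m n x y z =
  0 < x × 0 < y × 0 < z × SolvesEq m n x y z × n ∣ y × n ∣ z × Coprime n x

{-# OPTIONS --safe #-}
module Submission where

-- Writing y = ny' and z = nz', the equation becomes mxy'z' = ny'z' + x(y' + z'); hence n < mx, and
-- with e = mx - n it reads ey'z' = x(y' + z'). Since x divides n + e, gcd(n, x) = 1 iff gcd(e, x) = 1.
-- Dividing y' and z' by g = gcd(y', z') leaves coprime a, b with e·ab·g = x(a + b), so ab ∣ x, say
-- x = tab; then eg = t(a + b) with gcd(e, t) = 1 forces e ∣ a + b. Conversely, from a + b = er and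
-- n + e = qmab, the triple x = qab, y = nqra, z = nqrb is a Type II solution.

open import Defs
open import Data.Nat using (ℕ; _+_; _*_; _<_; NonZero)
open import Data.Nat.DivMod using (_/_)
open import Data.Nat.Divisibility using (_∣_)
open import Data.Nat.Coprimality using (Coprime)
open import Data.Product using (_×_; ∃-syntax)
open import Function.Bundles using (_⇔_)

open import Data.List.Base using ([]; _∷_)
open import Data.Nat.Base using (suc; _>_; _∸_; z<s; >-nonZero; ≢-nonZero)
open import Data.Nat.Properties
  using (+-comm; *-comm; *-assoc; *-distribʳ-+; +-cancelˡ-≡; *-cancelˡ-≡; *-cancelʳ-<; m*n≢0;
         m<m+n; m≤m+n; <-≤-trans; <⇒≤; m+[n∸m]≡n; m<n⇒0<n∸m; n≢0⇒n>0; n>0⇒n≢0; module ≤-Reasoning)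
open import Data.Nat.Divisibility
  using (divides; quotient; quotient-∣; m∣n⇒n≡quotient*m; n/m≡quotient; ∣-trans; ∣m+n∣m⇒∣n;
         m∣m*n; m*n∣⇒m∣; m*n∣⇒n∣; *-monoʳ-∣; *-monoˡ-∣; *-cancelʳ-∣)
open import Data.Nat.Coprimality using (coprime-divisor; coprime-/gcd) renaming (sym to coprime-sym)
open import Data.Nat.DivMod using (m/n*n≡m)
open import Data.Nat.GCD using (gcd; gcd[m,n]∣m; gcd[m,n]∣n; gcd[m,n]≢0)
open import Data.Nat.Tactic.RingSolver using (solve)
open import Data.Product using (_,_)
open import Data.Sum using (inj₁)
open import Function.Bundles using (mk⇔; Equivalence)
open import Relation.Binary.PropositionalEquality
  using (_≡_; _≢_; refl; sym; trans; cong; subst; subst₂; module ≡-Reasoning)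

m*n>0 : ∀ {m n} → m > 0 → n > 0 → m * n > 0
m*n>0 {suc _} {suc _} _ _ = z<s

m*n>0⇒m>0 : ∀ {m n} → m * n > 0 → m > 0
m*n>0⇒m>0 {suc _} _ = z<s

coprime-*∣ : ∀ {u v x} → Coprime u v → u ∣ x → v ∣ x → u * v ∣ x
coprime-*∣ {u} {v} u⊥v (divides s refl) v∣su =
  subst (u * v ∣_) (*-comm u s)
    (*-monoʳ-∣ u (coprime-divisor (coprime-sym u⊥v) (subst (v ∣_) (*-comm s u) v∣su)))

coprime-∣+*⇒∣ : ∀ {u v x} → Coprime u v → u ∣ (u + v) * x → u ∣ x
coprime-∣+*⇒∣ {u} {v} {x} u⊥v u∣[u+v]x =
  coprime-divisor u⊥v (∣m+n∣m⇒∣n (subst (u ∣_) (*-distribʳ-+ x u v) u∣[u+v]x) (m∣m*n x))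

coprime-*∣+*⇒*∣ : ∀ {u v x} → Coprime u v → u * v ∣ (u + v) * x → u * v ∣ x
coprime-*∣+*⇒*∣ {u} {v} {x} u⊥v uv∣[u+v]x = coprime-*∣ u⊥v
  (coprime-∣+*⇒∣ u⊥v (m*n∣⇒m∣ u v uv∣[u+v]x))
  (coprime-∣+*⇒∣ (coprime-sym u⊥v) (subst (λ w → v ∣ w * x) (+-comm u v) (m*n∣⇒n∣ u v uv∣[u+v]x)))

coprime-*∣+*⇒∣+×*∣ : ∀ {u v e x} → Coprime u v → Coprime e x → .{{NonZero (u * v)}} →
  e * (u * v) ∣ (u + v) * x → e ∣ u + v × u * v ∣ x
coprime-*∣+*⇒∣+×*∣ {u} {v} {e} {x} u⊥v e⊥x e[uv]∣[u+v]x = coprime-divisor e⊥t e∣t[u+v] , uv∣x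
  where
  uv∣x : u * v ∣ x
  uv∣x = coprime-*∣+*⇒*∣ u⊥v (m*n∣⇒n∣ e (u * v) e[uv]∣[u+v]x)
  t : ℕ
  t = quotient uv∣x
  e⊥t : Coprime e t
  e⊥t (d∣e , d∣t) = e⊥x (d∣e , ∣-trans d∣t (quotient-∣ uv∣x))
  e∣t[u+v] : e ∣ t * (u + v)
  e∣t[u+v] = subst (e ∣_) (*-comm (u + v) t) (*-cancelʳ-∣ (u * v) (subst (e * (u * v) ∣_)
    (trans (cong ((u + v) *_) (m∣n⇒n≡quotient*m uv∣x)) (sym (*-assoc (u + v) t (u * v))))
    e[uv]∣[u+v]x))

gcd-cofactors : ∀ y z → y > 0 →
  ∃[ g ] ∃[ u ] ∃[ v ] (g > 0 × Coprime u v × y ≡ u * g × z ≡ v * g)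
gcd-cofactors y z y>0 =
  gcd y z , y / gcd y z , z / gcd y z , n≢0⇒n>0 gcd≢0 , coprime-/gcd y z ,
  sym (m/n*n≡m (gcd[m,n]∣m y z)) , sym (m/n*n≡m (gcd[m,n]∣n y z))
  where
  gcd≢0 : gcd y z ≢ 0
  gcd≢0 = gcd[m,n]≢0 y z (inj₁ (n>0⇒n≢0 y>0))
  instance
    _ : NonZero (gcd y z)
    _ = ≢-nonZero gcd≢0

reduced-cofactors : ∀ {e x y z} → Coprime e x → y > 0 → z > 0 → e * (y * z) ≡ x * (y + z) →
  ∃[ a ] ∃[ b ] (a > 0 × b > 0 × e ∣ a + b × a * b ∣ x)
reduced-cofactors {e} {x} {y} {z} e⊥x y>0 z>0 eq with gcd-cofactors y z y>0
... | g , a , b , g>0 , a⊥b , refl , refl =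
  a , b , a>0 , b>0 , coprime-*∣+*⇒∣+×*∣ a⊥b e⊥x (divides g [a+b]x≡g[e[ab]])
  where
  a>0 : a > 0
  a>0 = m*n>0⇒m>0 y>0
  b>0 : b > 0
  b>0 = m*n>0⇒m>0 z>0
  instance
    _ : NonZero g
    _ = >-nonZero g>0
    _ : NonZero (a * b)
    _ = m*n≢0 a b {{>-nonZero a>0}} {{>-nonZero b>0}}
  [a+b]x≡g[e[ab]] : (a + b) * x ≡ g * (e * (a * b))
  [a+b]x≡g[e[ab]] = *-cancelˡ-≡ _ _ g (begin
    g * ((a + b) * x)       ≡⟨ solve (a ∷ b ∷ g ∷ x ∷ []) ⟩
    x * (a * g + b * g)     ≡⟨ sym eq ⟩
    e * (a * g * (b * g))   ≡⟨ solve (a ∷ b ∷ g ∷ e ∷ []) ⟩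
    g * (g * (e * (a * b))) ∎)
    where open ≡-Reasoning

solvesEq-*n⇔ : ∀ m n x y z → .{{NonZero n}} →
  SolvesEq m n x (y * n) (z * n) ⇔ x * m * (y * z) ≡ n * (y * z) + x * (y + z)
solvesEq-*n⇔ m n x y z = mk⇔
  (λ sol → *-cancelˡ-≡ _ _ (n * n) (trans (sym lhs) (trans sol rhs)))
  (λ eq → trans lhs (trans (cong (n * n *_) eq) (sym rhs)))
  where
  instance
    _ : NonZero (n * n)
    _ = m*n≢0 n n
  lhs : m * (x * (y * n) * (z * n)) ≡ n * n * (x * m * (y * z))
  lhs = solve (n ∷ m ∷ x ∷ y ∷ z ∷ [])
  rhs : n * (y * n * (z * n) + x * (z * n) + x * (y * n)) ≡ n * n * (n * (y * z) + x * (y + z))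
  rhs = solve (n ∷ x ∷ y ∷ z ∷ [])

k*w≡n*w+s⇔e*w≡s : ∀ {n e k w s} → n + e ≡ k → (k * w ≡ n * w + s ⇔ e * w ≡ s)
k*w≡n*w+s⇔e*w≡s {n} {e} {k} {w} {s} n+e≡k = mk⇔
  (λ eq → +-cancelˡ-≡ (n * w) _ _ (trans (sym k*w≡n*w+e*w) eq))
  (λ eq → trans k*w≡n*w+e*w (cong (n * w +_) eq))
  where
  k*w≡n*w+e*w : k * w ≡ n * w + e * w
  k*w≡n*w+e*w = trans (cong (_* w) (sym n+e≡k)) (*-distribʳ-+ w n e)

coprime-∣+ : ∀ {x n e} → x ∣ n + e → Coprime n x → Coprime e x
coprime-∣+ {x} {n} {e} x∣n+e n⊥x {d} (d∣e , d∣x) =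
  n⊥x (∣m+n∣m⇒∣n (subst (d ∣_) (+-comm n e) (∣-trans d∣x x∣n+e)) d∣e , d∣x)

HasTypeIISolution : ℕ → ℕ → Set
HasTypeIISolution m n = ∃[ x ] ∃[ y ] ∃[ z ] TypeIISolution m n x y z

HasTypeIIParameters : (m n : ℕ) → .{{NonZero m}} → Set
HasTypeIIParameters m n =
  ∃[ a ] ∃[ b ] ∃[ e ] (0 < a × 0 < b × 0 < e × e ∣ a + b × m * a * b ∣ n + e × Coprime ((n + e) / m) n)

typeII⇒parameters : ∀ {n m} → n > 0 → .{{_ : NonZero m}} →
  HasTypeIISolution m n → HasTypeIIParameters m n
typeII⇒parameters {n} {m} n>0
  (x , _ , _ , x>0 , yn>0 , zn>0 , sol , divides y refl , divides z refl , n⊥x) =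
  let (a , b , a>0 , b>0 , e∣a+b , ab∣x) = reduced-cofactors e⊥x y>0 z>0 reduced
  in a , b , e , a>0 , b>0 , m<n⇒0<n∸m n<xm , e∣a+b , mab∣n+e ab∣x , [n+e]/m⊥n
  where
  instance
    _ : NonZero n
    _ = >-nonZero n>0
  y>0 : y > 0
  y>0 = m*n>0⇒m>0 yn>0
  z>0 : z > 0
  z>0 = m*n>0⇒m>0 zn>0
  scaled : x * m * (y * z) ≡ n * (y * z) + x * (y + z)
  scaled = Equivalence.to (solvesEq-*n⇔ m n x y z) sol
  n<xm : n < x * m
  n<xm = *-cancelʳ-< (y * z) n (x * m) (begin-strict
    n * (y * z)               <⟨ m<m+n _ (m*n>0 x>0 (<-≤-trans y>0 (m≤m+n y z))) ⟩
    n * (y * z) + x * (y + z) ≡⟨ sym scaled ⟩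
    x * m * (y * z)           ∎)
    where open ≤-Reasoning
  e : ℕ
  e = x * m ∸ n
  n+e≡xm : n + e ≡ x * m
  n+e≡xm = m+[n∸m]≡n (<⇒≤ n<xm)
  e⊥x : Coprime e x
  e⊥x = coprime-∣+ (divides m (trans n+e≡xm (*-comm x m))) n⊥x
  reduced : e * (y * z) ≡ x * (y + z)
  reduced = Equivalence.to (k*w≡n*w+s⇔e*w≡s {n = n} n+e≡xm) scaled
  mab∣n+e : ∀ {a b} → a * b ∣ x → m * a * b ∣ n + e
  mab∣n+e {a} {b} ab∣x = subst₂ _∣_ (trans (*-comm (a * b) m) (sym (*-assoc m a b))) (sym n+e≡xm)
    (*-monoˡ-∣ m ab∣x)
  [n+e]/m⊥n : Coprime ((n + e) / m) n
  [n+e]/m⊥n = subst (λ w → Coprime w n) (sym (n/m≡quotient (divides x n+e≡xm))) (coprime-sym n⊥x)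

-- Inverts the forward direction, where x = (n + e)/m = qab and gcd(y/n, z/n) = qr.
parameters⇒typeII : ∀ {n m} → n > 0 → .{{_ : NonZero m}} →
  HasTypeIIParameters m n → HasTypeIISolution m n
parameters⇒typeII {n} {m} n>0
  (a , b , e , a>0 , b>0 , _ , divides r a+b≡re , divides q n+e≡q[mab] , [n+e]/m⊥n) =
  q * a * b , a * q * r * n , b * q * r * n ,
  m*n>0 (m*n>0 q>0 a>0) b>0 , m*n>0 (m*n>0 (m*n>0 a>0 q>0) r>0) n>0 ,
  m*n>0 (m*n>0 (m*n>0 b>0 q>0) r>0) n>0 ,
  sol , divides (a * q * r) refl , divides (b * q * r) refl , n⊥qab
  where
  instance
    _ : NonZero n
    _ = >-nonZero n>0
  q>0 : q > 0
  q>0 = m*n>0⇒m>0 (subst (_> 0) n+e≡q[mab] (<-≤-trans n>0 (m≤m+n n e)))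
  r>0 : r > 0
  r>0 = m*n>0⇒m>0 (subst (_> 0) a+b≡re (<-≤-trans a>0 (m≤m+n a b)))
  n+e≡qabm : n + e ≡ q * a * b * m
  n+e≡qabm = trans n+e≡q[mab] (solve (q ∷ m ∷ a ∷ b ∷ []))
  reduced : e * (a * q * r * (b * q * r)) ≡ q * a * b * (a * q * r + b * q * r)
  reduced = begin
    e * (a * q * r * (b * q * r))       ≡⟨ solve (e ∷ a ∷ b ∷ q ∷ r ∷ []) ⟩
    q * a * b * q * r * (r * e)         ≡⟨ cong (q * a * b * q * r *_) (sym a+b≡re) ⟩
    q * a * b * q * r * (a + b)         ≡⟨ solve (a ∷ b ∷ q ∷ r ∷ []) ⟩
    q * a * b * (a * q * r + b * q * r) ∎
    where open ≡-Reasoning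
  sol : SolvesEq m n (q * a * b) (a * q * r * n) (b * q * r * n)
  sol = Equivalence.from (solvesEq-*n⇔ m n (q * a * b) (a * q * r) (b * q * r))
    (Equivalence.from (k*w≡n*w+s⇔e*w≡s {n = n} n+e≡qabm) reduced)
  n⊥qab : Coprime n (q * a * b)
  n⊥qab = coprime-sym
    (subst (λ w → Coprime w n) (n/m≡quotient (divides (q * a * b) n+e≡qabm)) [n+e]/m⊥n)

proposition2p3 : (n m : ℕ) → 0 < n → .{{_ : NonZero m}} →
    (∃[ x ] ∃[ y ] ∃[ z ] TypeIISolution m n x y z)
    ⇔ (∃[ a ] ∃[ b ] ∃[ e ] (0 < a × 0 < b × 0 < e × e ∣ a + b × m * a * b ∣ n + e × Coprime ((n + e) / m) n))
proposition2p3 n m n>0 = mk⇔ (typeII⇒parameters n>0) (parameters⇒typeII n>0)
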